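{- Let $(p_1,\ldots,p_{n-1})$ be an admissible $(n-1)$-tuple and let $1\le i\le n-1$ be such that $p_i$ is even. Then every element of $\Gamma(p_1,\ldots,p_{n-1})$ either commutes with $(x_{i-1}x_i)^2$ or inverts it by conjugation. In particular, the square of every element of $\Gamma(p_1,\ldots,p_{n-1})$ commutes with $(x_{i-1}x_i)^2$.
   Context: An $(n-1)$-tuple $(p_1,\ldots,p_{n-1})$ of integers $\ge 2$ is admissible if whenever $p_i$ is odd, each of $p_{i-1}$ and $p_{i+1}$ (when its index lies in $\{1,\ldots,n-1\}$) is an even divisor of $2p_i$; in particular no two consecutive entries are odd. For such a tuple, $\Gamma(p_1,\ldots,p_{n-1})$ is the group generated by $x_0,\ldots,x_{n-1}$ subject to the relations $x_j^2=1$ ($0\le j\le n-1$), $(x_{j-1}x_j)^{p_j}=1$ ($1\le j\le n-1$), $(x_jx_k)^2=1$ for $|j-k|\ge 2$, and $r_j=1$ for $1\le j\le n-2$, where $r_j=(x_{j-1}x_jx_{j+1}x_j)^2$ if $p_j$ and $p_{j+1}$ are both even, $r_j=(x_{j-1}x_jx_{j+1}x_jx_{j+1})^2$ if $p_j$ is odd and $p_{j+1}$ even, and $r_j=(x_{j+1}x_jx_{j-1}x_jx_{j-1})^2$ if $p_j$ is even and $p_{j+1}$ odd. -}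

module Defs where

open import Data.Nat using (ℕ; zero; suc; _+_; _*_; _∸_; _≤_; _<_)
open import Data.Nat.Divisibility using (_∣_)
open import Data.List using (List; []; _∷_; _++_; reverse)
open import Data.Product using (_×_)
open import Data.Sum using (_⊎_)
open import Relation.Nullary using (¬_)

Even : ℕ → Set
Even k = 2 ∣ k

Odd : ℕ → Set
Odd k = ¬ Even k

-- The tuple (p_1,…,p_{n-1}) is encoded as p : ℕ → ℕ; only p 1, …, p (n-1) matter.
-- Admissibility of (p_1,…,p_{n-1}).
Admissible : ℕ → (ℕ → ℕ) → Set
Admissible n p =
  (∀ i → 1 ≤ i → i ≤ n ∸ 1 → 2 ≤ p i) ×
  ((∀ i → 1 ≤ i → i ≤ n ∸ 1 → Odd (p i) →
      (2 ≤ i → Even (p (i ∸ 1)) × p (i ∸ 1) ∣ 2 * p i)) ×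
   (∀ i → 1 ≤ i → i + 1 ≤ n ∸ 1 → Odd (p i) →
      (Even (p (i + 1)) × p (i + 1) ∣ 2 * p i)))

-- Words in the generators x_0,…,x_{n-1} (generator x_j is the letter j).
Word : Set
Word = List ℕ

pow : Word → ℕ → Word
pow w zero = []
pow w (suc k) = w ++ pow w k

data Relator (n : ℕ) (p : ℕ → ℕ) : Word → Set where
  invol : ∀ j → j < n → Relator n p (j ∷ j ∷ [])
  braid : ∀ j → 1 ≤ j → j ≤ n ∸ 1 →
          Relator n p (pow ((j ∸ 1) ∷ j ∷ []) (p j))
  commL : ∀ j k → j < n → k < n → j + 2 ≤ k →
          Relator n p (pow (j ∷ k ∷ []) 2)
  commR : ∀ j k → j < n → k < n → k + 2 ≤ j →
          Relator n p (pow (j ∷ k ∷ []) 2)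
  rEE : ∀ j → 1 ≤ j → j ≤ n ∸ 2 → Even (p j) → Even (p (j + 1)) →
        Relator n p (pow ((j ∸ 1) ∷ j ∷ (j + 1) ∷ j ∷ []) 2)
  rOE : ∀ j → 1 ≤ j → j ≤ n ∸ 2 → Odd (p j) → Even (p (j + 1)) →
        Relator n p (pow ((j ∸ 1) ∷ j ∷ (j + 1) ∷ j ∷ (j + 1) ∷ []) 2)
  rEO : ∀ j → 1 ≤ j → j ≤ n ∸ 2 → Even (p j) → Odd (p (j + 1)) →
        Relator n p (pow ((j + 1) ∷ j ∷ (j ∸ 1) ∷ j ∷ (j ∸ 1) ∷ []) 2)

-- Equality in Γ: the congruence on words generated by r = 1 for all relators r.
-- (Since every generator is an involution, the monoid presentation below
--  presents the group Γ; the inverse of a word w is reverse w.)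
data Eq (n : ℕ) (p : ℕ → ℕ) : Word → Word → Set where
  del   : ∀ u r v → Relator n p r → Eq n p (u ++ r ++ v) (u ++ v)
  refl  : ∀ {w} → Eq n p w w
  sym   : ∀ {u v} → Eq n p u v → Eq n p v u
  trans : ∀ {u v w} → Eq n p u v → Eq n p v w → Eq n p u w

-- Write c = (x_{i-1} x_i)^2.  The elements g with g c g⁻¹ ∈ {c, c⁻¹} form a
-- subgroup, so it suffices to check that every generator x_j fixes or inverts c.
-- For |j - i| large x_j commutes with x_{i-1} and x_i; x_{i-1} and x_i invert c;
-- for j = i+1 (resp. j = i-2) the relator r_i (resp. r_{i-1}) shows that
-- x_j fixes or inverts c, according to the parity of p_{i+1} (resp. p_{i-1}).
-- If g c g⁻¹ = c^{±1} then g² c g⁻² = c.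
module Submission where

open import Defs
open import Data.Nat using (ℕ; zero; suc; _+_; _∸_; _≤_; _<_; z≤n; s≤s)
open import Data.Nat.Properties using (+-comm; ≤-trans; ≤-reflexive; n≤1+n; <-trans; n<1+n; ∸-monoˡ-≤)
open import Data.Nat.Divisibility using (_∣?_)
open import Data.List using (_∷_; []; _++_; reverse; [_])
open import Data.List.Properties
  using (++-assoc; ++-identityʳ; unfold-reverse; reverse-++; reverse-involutive)
open import Data.List.Relation.Unary.All using (All; []; _∷_)
open import Data.List.Relation.Unary.All.Properties using (++⁺)
open import Function using (_∘_)
open import Data.Product using (_×_; _,_)
open import Data.Sum using (_⊎_; inj₁; inj₂)
open import Level using (0ℓ)
open import Relation.Nullary using (yes; no)
open import Relation.Binary.Bundles using (Setoid)
open import Relation.Binary.PropositionalEquality as ≡ using (_≡_; subst; cong)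
import Relation.Binary.Reasoning.Setoid as SetoidReasoning

module WordGroup (n : ℕ) (p : ℕ → ℕ) where

  infix 4 _≈_
  _≈_ : Word → Word → Set
  _≈_ = Eq n p

  word-setoid : Setoid 0ℓ 0ℓ
  word-setoid = record
    { Carrier = Word
    ; _≈_ = _≈_
    ; isEquivalence = record { refl = refl ; sym = sym ; trans = trans }
    }

  open SetoidReasoning word-setoid

  Valid : Word → Set
  Valid = All (_< n)

  ≡⇒≈ : ∀ {u v} → u ≡ v → u ≈ v
  ≡⇒≈ ≡.refl = refl

  ++-congˡ : ∀ x {u v} → u ≈ v → x ++ u ≈ x ++ v
  ++-congˡ x (del u r v R) =
    subst (λ t → t ≈ x ++ u ++ v) (++-assoc x u (r ++ v))
      (subst (λ t → (x ++ u) ++ r ++ v ≈ t) (++-assoc x u v) (del (x ++ u) r v R))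
  ++-congˡ x refl = refl
  ++-congˡ x (sym e) = sym (++-congˡ x e)
  ++-congˡ x (trans e f) = trans (++-congˡ x e) (++-congˡ x f)

  ++-congʳ : ∀ y {u v} → u ≈ v → u ++ y ≈ v ++ y
  ++-congʳ y (del u r v R) = begin
    (u ++ r ++ v) ++ y  ≡⟨ ≡.trans (++-assoc u (r ++ v) y) (cong (u ++_) (++-assoc r v y)) ⟩
    u ++ r ++ v ++ y    ≈⟨ del u r (v ++ y) R ⟩
    u ++ v ++ y         ≡⟨ ++-assoc u v y ⟨
    (u ++ v) ++ y       ∎
  ++-congʳ y refl = refl
  ++-congʳ y (sym e) = sym (++-congʳ y e)
  ++-congʳ y (trans e f) = trans (++-congʳ y e) (++-congʳ y f)

  cancel : ∀ u {j} v → j < n → u ++ j ∷ j ∷ v ≈ u ++ v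
  cancel u {j} v j<n = del u (j ∷ j ∷ []) v (invol j j<n)

  commute : ∀ {x y} u v → Relator n p (x ∷ y ∷ x ∷ y ∷ []) → x < n → y < n →
            u ++ y ∷ x ∷ v ≈ u ++ x ∷ y ∷ v
  commute {x} {y} u v R x<n y<n = ++-congˡ u (begin
    y ∷ x ∷ v                          ≈⟨ del (y ∷ x ∷ []) _ v R ⟨
    y ∷ x ∷ x ∷ y ∷ x ∷ y ∷ v          ≈⟨ cancel (y ∷ []) _ x<n ⟩
    y ∷ y ∷ x ∷ y ∷ v                  ≈⟨ cancel [] _ y<n ⟩
    x ∷ y ∷ v                          ∎)

  reverse-valid : ∀ {u} → Valid u → Valid (reverse u)
  reverse-valid {[]} [] = []
  reverse-valid {j ∷ u} (j<n ∷ valid) rewrite unfold-reverse j u =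
    ++⁺ (reverse-valid valid) (j<n ∷ [])

  reverse-inverseʳ : ∀ {u} → Valid u → u ++ reverse u ≈ []
  reverse-inverseʳ {[]} [] = refl
  reverse-inverseʳ {j ∷ u} (j<n ∷ valid) = begin
    j ∷ u ++ reverse (j ∷ u)      ≡⟨ cong (λ t → j ∷ u ++ t) (unfold-reverse j u) ⟩
    j ∷ u ++ reverse u ++ [ j ]   ≡⟨ cong (j ∷_) (++-assoc u (reverse u) [ j ]) ⟨
    j ∷ (u ++ reverse u) ++ [ j ] ≈⟨ ++-congˡ [ j ] (++-congʳ [ j ] (reverse-inverseʳ valid)) ⟩
    j ∷ j ∷ []                    ≈⟨ cancel [] [] j<n ⟩
    []                            ∎

  reverse-inverseˡ : ∀ {u} → Valid u → reverse u ++ u ≈ []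
  reverse-inverseˡ {u} valid =
    subst (λ t → reverse u ++ t ≈ []) (reverse-involutive u)
      (reverse-inverseʳ (reverse-valid valid))

  reverse-cong : ∀ {u v} → Valid u → Valid v → u ≈ v → reverse u ≈ reverse v
  reverse-cong {u} {v} valid-u valid-v u≈v = begin
    reverse u                          ≡⟨ ++-identityʳ (reverse u) ⟨
    reverse u ++ []                    ≈⟨ ++-congˡ (reverse u) (reverse-inverseʳ valid-v) ⟨
    reverse u ++ v ++ reverse v        ≡⟨ ++-assoc (reverse u) v (reverse v) ⟨
    (reverse u ++ v) ++ reverse v      ≈⟨ ++-congʳ (reverse v) (++-congˡ (reverse u) u≈v) ⟨
    (reverse u ++ u) ++ reverse v      ≈⟨ ++-congʳ (reverse v) (reverse-inverseˡ valid-u) ⟩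
    reverse v                          ∎

  conjugate : Word → Word → Word
  conjugate w X = w ++ X ++ reverse w

  conjugate-∷ : ∀ j w X → conjugate (j ∷ w) X ≡ j ∷ conjugate w X ++ [ j ]
  conjugate-∷ j w X rewrite unfold-reverse j w = cong (j ∷_) (≡.sym
    (≡.trans (++-assoc w (X ++ reverse w) [ j ]) (cong (w ++_) (++-assoc X (reverse w) [ j ]))))

  conjugate-valid : ∀ {w X} → Valid w → Valid X → Valid (conjugate w X)
  conjugate-valid valid-w valid-X = ++⁺ valid-w (++⁺ valid-X (reverse-valid valid-w))

  reverse-conjugate : ∀ w X → reverse (conjugate w X) ≡ conjugate w (reverse X)
  reverse-conjugate w X rewrite reverse-++ w (X ++ reverse w) | reverse-++ X (reverse w)
                              | reverse-involutive w = ++-assoc w (reverse X) (reverse w)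

  conjugate-reverse : ∀ {w X Y} → Valid w → Valid X → Valid Y →
                      conjugate w X ≈ Y → conjugate w (reverse X) ≈ reverse Y
  conjugate-reverse {w} {X} valid-w valid-X valid-Y e =
    subst (_≈ _) (reverse-conjugate w X)
      (reverse-cong (conjugate-valid valid-w valid-X) valid-Y e)

  conjugate⇒commute : ∀ {w X Y} → Valid w → conjugate w X ≈ Y → w ++ X ≈ Y ++ w
  conjugate⇒commute {w} {X} {Y} valid e = begin
    w ++ X                         ≡⟨ ++-identityʳ (w ++ X) ⟨
    (w ++ X) ++ []                 ≈⟨ ++-congˡ (w ++ X) (reverse-inverseˡ valid) ⟨
    (w ++ X) ++ reverse w ++ w     ≡⟨ ≡.trans (++-assoc w X _) (cong (w ++_) (≡.sym (++-assoc X (reverse w) w))) ⟩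
    w ++ (X ++ reverse w) ++ w     ≡⟨ ++-assoc w (X ++ reverse w) w ⟨
    conjugate w X ++ w             ≈⟨ ++-congʳ w e ⟩
    Y ++ w                         ∎

  FixesOrInverts : Word → Word → Set
  FixesOrInverts X w = conjugate w X ≈ X ⊎ conjugate w X ≈ reverse X

  conjugate-∷-cong : ∀ j w {X Z} → conjugate w X ≈ Z → conjugate (j ∷ w) X ≈ conjugate [ j ] Z
  conjugate-∷-cong j w {X} e =
    trans (≡⇒≈ (conjugate-∷ j w X)) (++-congˡ [ j ] (++-congʳ [ j ] e))

  fixesOrInverts-∷ : ∀ {X} j w → Valid X → j < n →
    FixesOrInverts X [ j ] → FixesOrInverts X w → FixesOrInverts X (j ∷ w)
  fixesOrInverts-∷ j w valid j<n (inj₁ e) (inj₁ f) = inj₁ (trans (conjugate-∷-cong j w f) e)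
  fixesOrInverts-∷ j w valid j<n (inj₂ e) (inj₁ f) = inj₂ (trans (conjugate-∷-cong j w f) e)
  fixesOrInverts-∷ j w valid j<n (inj₁ e) (inj₂ f) =
    inj₂ (trans (conjugate-∷-cong j w f) (conjugate-reverse (j<n ∷ []) valid valid e))
  fixesOrInverts-∷ {X} j w valid j<n (inj₂ e) (inj₂ f) =
    inj₁ (trans (conjugate-∷-cong j w f)
      (subst (conjugate [ j ] (reverse X) ≈_) (reverse-involutive X)
        (conjugate-reverse (j<n ∷ []) valid (reverse-valid valid) e)))

  fixesOrInverts-by-letters : ∀ {X} → Valid X →
    (∀ {j} → j < n → FixesOrInverts X [ j ]) →
    ∀ {w} → Valid w → FixesOrInverts X w
  fixesOrInverts-by-letters {X} valid letter [] = inj₁ (≡⇒≈ (++-identityʳ X))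
  fixesOrInverts-by-letters valid letter {j ∷ w} (j<n ∷ valid-w) =
    fixesOrInverts-∷ j w valid j<n (letter j<n) (fixesOrInverts-by-letters valid letter valid-w)

  conjugate-twice⇒square-commutes : ∀ {w X Y} → Valid w →
    conjugate w X ≈ Y → conjugate w Y ≈ X → w ++ w ++ X ≈ X ++ w ++ w
  conjugate-twice⇒square-commutes {w} {X} {Y} valid e f = begin
    w ++ w ++ X    ≈⟨ ++-congˡ w (conjugate⇒commute valid e) ⟩
    w ++ Y ++ w    ≡⟨ ++-assoc w Y w ⟨
    (w ++ Y) ++ w  ≈⟨ ++-congʳ w (conjugate⇒commute valid f) ⟩
    (X ++ w) ++ w  ≡⟨ ++-assoc X w w ⟩
    X ++ w ++ w    ∎

  fixesOrInverts⇒square-commutes : ∀ {X w} → Valid X → Valid w →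
    FixesOrInverts X w → w ++ w ++ X ≈ X ++ w ++ w
  fixesOrInverts⇒square-commutes valid-X valid-w (inj₁ e) =
    conjugate-twice⇒square-commutes valid-w e e
  fixesOrInverts⇒square-commutes {X} {w} valid-X valid-w (inj₂ e) =
    conjugate-twice⇒square-commutes valid-w e
      (subst (conjugate w (reverse X) ≈_) (reverse-involutive X)
        (conjugate-reverse valid-w valid-X (reverse-valid valid-X) e))

  conjugate-by-commuting : ∀ {j} X → j < n →
    All (λ x → x < n × Relator n p (j ∷ x ∷ j ∷ x ∷ [])) X → j ∷ X ++ [ j ] ≈ X
  conjugate-by-commuting [] j<n [] = cancel [] [] j<n
  conjugate-by-commuting {j} (x ∷ X) j<n ((x<n , R) ∷ commuting) = begin
    j ∷ x ∷ X ++ [ j ]  ≈⟨ commute [] (X ++ [ j ]) R j<n x<n ⟨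
    x ∷ j ∷ X ++ [ j ]  ≈⟨ ++-congˡ [ x ] (conjugate-by-commuting X j<n commuting) ⟩
    x ∷ X               ∎

  distant-commute : ∀ {j k} → j < n → k < n → j + 2 ≤ k ⊎ k + 2 ≤ j →
    Relator n p (j ∷ k ∷ j ∷ k ∷ [])
  distant-commute j<n k<n (inj₁ j+2≤k) = commL _ _ j<n k<n j+2≤k
  distant-commute j<n k<n (inj₂ k+2≤j) = commR _ _ j<n k<n k+2≤j

data Position : ℕ → ℕ → Set where
  same      : ∀ {a} → Position a a
  next      : ∀ {a} → Position a (suc a)
  next²     : ∀ {a} → Position a (suc (suc a))
  previous  : ∀ {e} → Position (suc e) e
  far-below : ∀ {a j} → j + 2 ≤ a → Position a j
  far-above : ∀ {a j} → suc a + 2 ≤ j → Position a j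

position-suc : ∀ {a j} → Position a j → Position (suc a) (suc j)
position-suc same = same
position-suc next = next
position-suc next² = next²
position-suc previous = previous
position-suc (far-below j+2≤a) = far-below (s≤s j+2≤a)
position-suc (far-above a+3≤j) = far-above (s≤s a+3≤j)

position : ∀ a j → Position a j
position zero zero = same
position zero (suc zero) = next
position zero (suc (suc zero)) = next²
position zero (suc (suc (suc j))) = far-above (s≤s (s≤s (s≤s z≤n)))
position (suc zero) zero = previous
position (suc (suc a)) zero = far-below (s≤s (s≤s z≤n))
position (suc a) (suc j) = position-suc (position a j)

rotation² : ℕ → Word
rotation² a = pow (a ∷ suc a ∷ []) 2

suc+1 : ∀ a → suc a + 1 ≡ suc (suc a)
suc+1 a = cong suc (+-comm a 1)

module RotationSquare (n : ℕ) (p : ℕ → ℕ) where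

  open WordGroup n p
  open SetoidReasoning word-setoid

  -- The relators r_{a+1}, with the index a + 1 + 1 normalised to a + 2.
  r-even-even : ∀ a → suc (suc a) < n → Even (p (suc a)) → Even (p (suc (suc a))) →
    Relator n p (pow (a ∷ suc a ∷ suc (suc a) ∷ suc a ∷ []) 2)
  r-even-even a a+2<n even even′ =
    subst (λ t → Relator n p (pow (a ∷ suc a ∷ t ∷ suc a ∷ []) 2)) (suc+1 a)
      (rEE (suc a) (s≤s z≤n) (∸-monoˡ-≤ 2 a+2<n) even (subst (Even ∘ p) (≡.sym (suc+1 a)) even′))

  r-even-odd : ∀ a → suc (suc a) < n → Even (p (suc a)) → Odd (p (suc (suc a))) →
    Relator n p (pow (suc (suc a) ∷ suc a ∷ a ∷ suc a ∷ a ∷ []) 2)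
  r-even-odd a a+2<n even odd =
    subst (λ t → Relator n p (pow (t ∷ suc a ∷ a ∷ suc a ∷ a ∷ []) 2)) (suc+1 a)
      (rEO (suc a) (s≤s z≤n) (∸-monoˡ-≤ 2 a+2<n) even (subst (Odd ∘ p) (≡.sym (suc+1 a)) odd))

  r-odd-even : ∀ a → suc (suc a) < n → Odd (p (suc a)) → Even (p (suc (suc a))) →
    Relator n p (pow (a ∷ suc a ∷ suc (suc a) ∷ suc a ∷ suc (suc a) ∷ []) 2)
  r-odd-even a a+2<n odd even =
    subst (λ t → Relator n p (pow (a ∷ suc a ∷ t ∷ suc a ∷ t ∷ []) 2)) (suc+1 a)
      (rOE (suc a) (s≤s z≤n) (∸-monoˡ-≤ 2 a+2<n) odd (subst (Even ∘ p) (≡.sym (suc+1 a)) even))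

  distant-fixes : ∀ {a j} → suc a < n → j < n →
    j + 2 ≤ a ⊎ a + 2 ≤ j → j + 2 ≤ suc a ⊎ suc a + 2 ≤ j →
    conjugate [ j ] (rotation² a) ≈ rotation² a
  distant-fixes {a} {j} b<n j<n far-from-a far-from-b =
    conjugate-by-commuting (rotation² a) j<n
      ((a<n , Ra) ∷ (b<n , Rb) ∷ (a<n , Ra) ∷ (b<n , Rb) ∷ [])
    where
    a<n : a < n
    a<n = <-trans (n<1+n a) b<n
    Ra : Relator n p (j ∷ a ∷ j ∷ a ∷ [])
    Ra = distant-commute j<n a<n far-from-a
    Rb : Relator n p (j ∷ suc a ∷ j ∷ suc a ∷ [])
    Rb = distant-commute j<n b<n far-from-b

  next²-fixes : ∀ a → suc (suc a) < n → Even (p (suc a)) → Even (p (suc (suc a))) →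
    conjugate [ suc (suc a) ] (rotation² a) ≈ rotation² a
  next²-fixes a d<n even even′ = begin
    d ∷ a ∷ b ∷ a ∷ b ∷ d ∷ []                               ≈⟨ commute [] _ Rad a<n d<n ⟩
    a ∷ d ∷ b ∷ a ∷ b ∷ d ∷ []                               ≈⟨ cancel [ a ] _ b<n ⟨
    a ∷ b ∷ b ∷ d ∷ b ∷ a ∷ b ∷ d ∷ []                       ≈⟨ cancel (a ∷ b ∷ b ∷ d ∷ b ∷ a ∷ b ∷ d ∷ []) [] b<n ⟨
    a ∷ b ∷ b ∷ d ∷ b ∷ a ∷ b ∷ d ∷ b ∷ b ∷ []               ≈⟨ cancel (a ∷ b ∷ []) _ a<n ⟨
    a ∷ b ∷ a ∷ a ∷ b ∷ d ∷ b ∷ a ∷ b ∷ d ∷ b ∷ b ∷ []       ≈⟨ cancel (a ∷ b ∷ a ∷ []) _ b<n ⟨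
    a ∷ b ∷ a ∷ b ∷ b ∷ a ∷ b ∷ d ∷ b ∷ a ∷ b ∷ d ∷ b ∷ b ∷ []
      ≈⟨ del (a ∷ b ∷ a ∷ b ∷ b ∷ []) _ [ b ] (r-even-even a d<n even even′) ⟩
    a ∷ b ∷ a ∷ b ∷ b ∷ b ∷ []                               ≈⟨ cancel (a ∷ b ∷ a ∷ b ∷ []) [] b<n ⟩
    a ∷ b ∷ a ∷ b ∷ []                                       ∎
    where
    b d : ℕ
    b = suc a
    d = suc (suc a)
    b<n : b < n
    b<n = <-trans (n<1+n b) d<n
    a<n : a < n
    a<n = <-trans (n<1+n a) b<n
    Rad : Relator n p (a ∷ d ∷ a ∷ d ∷ [])
    Rad = distant-commute a<n d<n (inj₁ (≤-reflexive (+-comm a 2)))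

  next²-inverts : ∀ a → suc (suc a) < n → Even (p (suc a)) → Odd (p (suc (suc a))) →
    conjugate [ suc (suc a) ] (rotation² a) ≈ reverse (rotation² a)
  next²-inverts a d<n even odd = begin
    d ∷ a ∷ b ∷ a ∷ b ∷ d ∷ []
      ≈⟨ del (d ∷ a ∷ b ∷ a ∷ b ∷ d ∷ []) _ [] (r-even-odd a d<n even odd) ⟨
    d ∷ a ∷ b ∷ a ∷ b ∷ d ∷ d ∷ b ∷ a ∷ b ∷ a ∷ d ∷ b ∷ a ∷ b ∷ a ∷ []
      ≈⟨ cancel (d ∷ a ∷ b ∷ a ∷ b ∷ []) _ d<n ⟩
    d ∷ a ∷ b ∷ a ∷ b ∷ b ∷ a ∷ b ∷ a ∷ d ∷ b ∷ a ∷ b ∷ a ∷ []  ≈⟨ cancel (d ∷ a ∷ b ∷ a ∷ []) _ b<n ⟩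
    d ∷ a ∷ b ∷ a ∷ a ∷ b ∷ a ∷ d ∷ b ∷ a ∷ b ∷ a ∷ []          ≈⟨ cancel (d ∷ a ∷ b ∷ []) _ a<n ⟩
    d ∷ a ∷ b ∷ b ∷ a ∷ d ∷ b ∷ a ∷ b ∷ a ∷ []                  ≈⟨ cancel (d ∷ a ∷ []) _ b<n ⟩
    d ∷ a ∷ a ∷ d ∷ b ∷ a ∷ b ∷ a ∷ []                          ≈⟨ cancel [ d ] _ a<n ⟩
    d ∷ d ∷ b ∷ a ∷ b ∷ a ∷ []                                  ≈⟨ cancel [] _ d<n ⟩
    b ∷ a ∷ b ∷ a ∷ []                                          ∎
    where
    b d : ℕ
    b = suc a
    d = suc (suc a)
    b<n : b < n
    b<n = <-trans (n<1+n b) d<n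
    a<n : a < n
    a<n = <-trans (n<1+n a) b<n

  previous-fixes : ∀ e → suc (suc e) < n → Even (p (suc e)) → Even (p (suc (suc e))) →
    conjugate [ e ] (rotation² (suc e)) ≈ rotation² (suc e)
  previous-fixes e b<n even even′ = begin
    e ∷ a ∷ b ∷ a ∷ b ∷ e ∷ []                    ≈⟨ commute (e ∷ a ∷ b ∷ a ∷ []) [] Reb e<n b<n ⟩
    e ∷ a ∷ b ∷ a ∷ e ∷ b ∷ []                    ≈⟨ cancel (e ∷ a ∷ b ∷ a ∷ e ∷ []) _ a<n ⟨
    e ∷ a ∷ b ∷ a ∷ e ∷ a ∷ a ∷ b ∷ []            ≈⟨ cancel (e ∷ a ∷ b ∷ a ∷ e ∷ a ∷ []) _ b<n ⟨
    e ∷ a ∷ b ∷ a ∷ e ∷ a ∷ b ∷ b ∷ a ∷ b ∷ []    ≈⟨ cancel (e ∷ a ∷ b ∷ a ∷ e ∷ a ∷ b ∷ []) _ a<n ⟨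
    e ∷ a ∷ b ∷ a ∷ e ∷ a ∷ b ∷ a ∷ a ∷ b ∷ a ∷ b ∷ []
      ≈⟨ del [] _ (a ∷ b ∷ a ∷ b ∷ []) (r-even-even e b<n even even′) ⟩
    a ∷ b ∷ a ∷ b ∷ []                            ∎
    where
    a b : ℕ
    a = suc e
    b = suc (suc e)
    a<n : a < n
    a<n = <-trans (n<1+n a) b<n
    e<n : e < n
    e<n = <-trans (n<1+n e) a<n
    Reb : Relator n p (e ∷ b ∷ e ∷ b ∷ [])
    Reb = distant-commute e<n b<n (inj₁ (≤-reflexive (+-comm e 2)))

  previous-inverts : ∀ e → suc (suc e) < n → Odd (p (suc e)) → Even (p (suc (suc e))) →
    conjugate [ e ] (rotation² (suc e)) ≈ reverse (rotation² (suc e))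
  previous-inverts e b<n odd even = begin
    e ∷ a ∷ b ∷ a ∷ b ∷ e ∷ []                            ≈⟨ cancel (e ∷ a ∷ b ∷ a ∷ b ∷ e ∷ []) [] a<n ⟨
    e ∷ a ∷ b ∷ a ∷ b ∷ e ∷ a ∷ a ∷ []                    ≈⟨ cancel (e ∷ a ∷ b ∷ a ∷ b ∷ e ∷ a ∷ []) _ b<n ⟨
    e ∷ a ∷ b ∷ a ∷ b ∷ e ∷ a ∷ b ∷ b ∷ a ∷ []            ≈⟨ cancel (e ∷ a ∷ b ∷ a ∷ b ∷ e ∷ a ∷ b ∷ []) _ a<n ⟨
    e ∷ a ∷ b ∷ a ∷ b ∷ e ∷ a ∷ b ∷ a ∷ a ∷ b ∷ a ∷ []
      ≈⟨ cancel (e ∷ a ∷ b ∷ a ∷ b ∷ e ∷ a ∷ b ∷ a ∷ []) _ b<n ⟨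
    e ∷ a ∷ b ∷ a ∷ b ∷ e ∷ a ∷ b ∷ a ∷ b ∷ b ∷ a ∷ b ∷ a ∷ []
      ≈⟨ del [] _ (b ∷ a ∷ b ∷ a ∷ []) (r-odd-even e b<n odd even) ⟩
    b ∷ a ∷ b ∷ a ∷ []                                    ∎
    where
    a b : ℕ
    a = suc e
    b = suc (suc e)
    a<n : a < n
    a<n = <-trans (n<1+n a) b<n

  letter-fixesOrInverts : ∀ {a j} → suc a < n → Even (p (suc a)) → j < n →
    Position a j → FixesOrInverts (rotation² a) [ j ]
  letter-fixesOrInverts {a} b<n even a<n same = inj₂ (cancel [] _ a<n)
  letter-fixesOrInverts {a} b<n even _ next = inj₂ (cancel (reverse (rotation² a)) [] b<n)
  letter-fixesOrInverts {a} b<n even d<n next² with 2 ∣? p (suc (suc a))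
  ... | yes even′ = inj₁ (next²-fixes a d<n even even′)
  ... | no odd = inj₂ (next²-inverts a d<n even odd)
  letter-fixesOrInverts {suc e} b<n even e<n previous with 2 ∣? p (suc e)
  ... | yes even′ = inj₁ (previous-fixes e b<n even′ even)
  ... | no odd = inj₂ (previous-inverts e b<n odd even)
  letter-fixesOrInverts {a} b<n even j<n (far-below j+2≤a) =
    inj₁ (distant-fixes b<n j<n (inj₁ j+2≤a) (inj₁ (≤-trans j+2≤a (n≤1+n a))))
  letter-fixesOrInverts {a} b<n even j<n (far-above a+3≤j) =
    inj₁ (distant-fixes b<n j<n (inj₂ (≤-trans (n≤1+n (a + 2)) a+3≤j)) (inj₂ a+3≤j))

proposition4p2 : (n : ℕ) (p : ℕ → ℕ) → Admissible n p →
    (i : ℕ) → 1 ≤ i → i ≤ n ∸ 1 → Even (p i) →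
    ((w : Word) → All (_< n) w →
    Eq n p (w ++ ((i ∸ 1) ∷ i ∷ (i ∸ 1) ∷ i ∷ []) ++ reverse w)
    ((i ∸ 1) ∷ i ∷ (i ∸ 1) ∷ i ∷ [])
    ⊎ Eq n p (w ++ ((i ∸ 1) ∷ i ∷ (i ∸ 1) ∷ i ∷ []) ++ reverse w)
    (reverse ((i ∸ 1) ∷ i ∷ (i ∸ 1) ∷ i ∷ []))) ×
    ((w : Word) → All (_< n) w →
    Eq n p (w ++ w ++ ((i ∸ 1) ∷ i ∷ (i ∸ 1) ∷ i ∷ []))
    (((i ∸ 1) ∷ i ∷ (i ∸ 1) ∷ i ∷ []) ++ w ++ w))
proposition4p2 zero p _ (suc a) _ ()
proposition4p2 (suc m) p _ (suc a) (s≤s z≤n) b≤m even = fixesOrInverts , squares-commute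
  where
  open WordGroup (suc m) p
  open RotationSquare (suc m) p

  a<n : a < suc m
  a<n = <-trans (n<1+n a) (s≤s b≤m)

  valid-rotation² : Valid (rotation² a)
  valid-rotation² = a<n ∷ s≤s b≤m ∷ a<n ∷ s≤s b≤m ∷ []

  fixesOrInverts : ∀ w → Valid w → FixesOrInverts (rotation² a) w
  fixesOrInverts w =
    fixesOrInverts-by-letters valid-rotation²
      (λ {j} j<n → letter-fixesOrInverts (s≤s b≤m) even j<n (position a j))

  squares-commute : ∀ w → Valid w → w ++ w ++ rotation² a ≈ rotation² a ++ w ++ w
  squares-commute w valid =
    fixesOrInverts⇒square-commutes valid-rotation² valid (fixesOrInverts w valid)
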